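{- Let $P$ be a prime and $C\subset\mathbb{Z}/P\mathbb{Z}$ non-empty. Suppose there exist $S'\subset\mathbb{Z}/P\mathbb{Z}$ with $S'=-S'$, $0\in S'$, $\operatorname{card}(S')\le t$, a real $0<\beta\le1$ and constants $c(l)>0$ depending only on $l$, such that for every integer $l\ge2$ and all $h_1,\dots,h_l\in\mathbb{Z}/P\mathbb{Z}$ with $h_i-h_j\notin S'$ for $i\ne j$, $d\big((C+h_1)\cap\dots\cap(C+h_l)\big)\le\frac{c(l)}{\beta^l}d(C)^l$. Let $B\subset\mathbb{Z}/P\mathbb{Z}$ with $\operatorname{card}(B)\ge\frac1{d(C)}$. Then for every integer $l\ge2$, $$\|f_C*f_B\|_l\le\frac c\beta,$$ where $c>0$ is a constant depending only on $t$ and $l$.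
   Context: $d(C)=\operatorname{card}(C)/P$, $f_C=\frac1{d(C)}1_C$, $f*g(n)=\frac1P\sum_yf(n-y)g(y)$, $\|f\|_l=\big(\frac1P\sum_n|f(n)|^l\big)^{1/l}$.
   Formalization: The parameter β and the constants $c(l)$ are rational numbers instead of reals. -}

module Defs where

open import Data.Nat as ℕ using (ℕ; zero; suc; NonZero)
open import Data.Nat.DivMod using (_mod_)
open import Data.Fin using (Fin; toℕ)
open import Data.Fin.Subset using (Subset; ⋂; ∣_∣)
open import Data.Vec using (lookup; tabulate)
open import Data.List using (map; allFin)
open import Data.Bool using (if_then_else_)
open import Data.Integer using (+_)
open import Data.Rational using (ℚ; 0ℚ; 1ℚ; _+_; _*_; _/_; 1/_; ≢-nonZero) renaming (∣_∣ to abs)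
open import Data.Rational.Properties using (_≟_)
open import Relation.Nullary using (yes; no)

-- Arithmetic in ℤ/Pℤ, represented as Fin P
module _ {P : ℕ} .{{_ : NonZero P}} where
  _⊕_ : Fin P → Fin P → Fin P
  x ⊕ y = (toℕ x ℕ.+ toℕ y) mod P

  ⊖_ : Fin P → Fin P
  ⊖ x = (P ℕ.∸ toℕ x) mod P

  _⊝_ : Fin P → Fin P → Fin P
  x ⊝ y = x ⊕ (⊖ y)

  zeroP : Fin P
  zeroP = 0 mod P

-- total inverse on ℚ (only ever applied to nonzero arguments)
inv : ℚ → ℚ
inv p with p ≟ 0ℚ
... | yes _ = 0ℚ
... | no ne = 1/_ p {{≢-nonZero ne}}

_^_ : ℚ → ℕ → ℚ
p ^ zero  = 1ℚ
p ^ suc n = p * (p ^ n)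

sumF : ∀ {n} → (Fin n → ℚ) → ℚ
sumF {zero}  f = 0ℚ
sumF {suc n} f = f Data.Fin.zero + sumF (λ i → f (Data.Fin.suc i))

module _ {P : ℕ} .{{_ : NonZero P}} where
  dens : Subset P → ℚ
  dens C = (+ ∣ C ∣) / P

  ind : Subset P → Fin P → ℚ
  ind C x = if lookup C x then 1ℚ else 0ℚ

  fSet : Subset P → Fin P → ℚ
  fSet C x = inv (dens C) * ind C x

  conv : (Fin P → ℚ) → (Fin P → ℚ) → Fin P → ℚ
  conv f g n = ((+ 1) / P) * sumF (λ y → f (n ⊝ y) * g y)

  -- ‖f‖_l ^ l = (1/P) Σ_n |f(n)|^l
  normPow : ℕ → (Fin P → ℚ) → ℚ
  normPow l f = ((+ 1) / P) * sumF (λ n → abs (f n) ^ l)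

  shift : Subset P → Fin P → Subset P
  shift C h = tabulate (λ x → lookup C (x ⊝ h))

  interShifts : ∀ {l} → Subset P → (Fin l → Fin P) → Subset P
  interShifts {l} C h = ⋂ (map (λ i → shift C (h i)) (allFin l))

module Submission where

-- Proof by the moment method. Put M(n) = Σ_y 1_C(n - y) 1_B(y) = P·(1_C * 1_B)(n) and,
-- for a tuple g = (g₁,…,g_k) of shifts, moment g m = (1/P) Σ_n 1_{⋂(C+gᵢ)}(n) M(n)^m.
-- Expanding one factor M(n) gives moment g (m+1) = Σ_{y∈B} moment (y,g) m, adding a
-- shift only shrinks the moment, and moment g 0 = d(⋂(C+gᵢ)). Call g separated if
-- gᵢ - gⱼ ∉ S' for i ≠ j. A shift y keeps (y,g) separated unless it is near some gᵢ
-- (differs from it by an element of S'), which happens for at most 2kt shifts y.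
-- Splitting the expanded sum accordingly yields, by induction on m for all k at once,
--   moment g m ≤ momentConst k m · (β⁻¹ d(C))^k · (β⁻¹ D)^m,   D = d(C)|B| ≥ 1,
-- the base case m = 0 being the hypothesis on k-fold intersections. Finally
-- f_C * f_B = M/D, so ‖f_C * f_B‖_l^l = D^(-l) · moment [] l ≤ momentConst 0 l · β^(-l).

open import Defs
open import Data.Nat as ℕ using (ℕ; zero; suc; NonZero) renaming (_≤_ to _≤ℕ_)
import Data.Nat.Properties as ℕP
open import Data.Nat.DivMod using (_%_; %-distribˡ-+; m%n%n≡m%n; [m+n]%n≡m%n; m<n⇒m%n≡m)
open import Data.Nat.Primality using (Prime)
open import Data.Integer as ℤ using (+_)
import Data.Integer.Properties as ℤP
open import Data.Rational using (ℚ; 0ℚ; 1ℚ; _+_; _*_; _/_; _≤_; _<_; positive; nonNegative; ≢-nonZero)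
  renaming (∣_∣ to abs)
import Data.Rational.Properties as ℚP
open import Data.Rational.Unnormalised using (mkℚᵘ; *≡*; *≤*)
import Data.Rational.Unnormalised.Properties as ℚᵘP
open import Data.Rational.Solver using (module +-*-Solver)
open import Data.Fin using (Fin; zero; suc; toℕ)
import Data.Fin.Properties as FinP
open import Data.Fin.Permutation using (permutation)
open import Data.Fin.Subset using (Subset; _∈_; _∉_; _∩_; ⋂; ∣_∣; Nonempty)
open import Data.Fin.Subset.Properties using (_∈?_; ∣⊤∣≡n)
open import Data.Vec as Vec using (lookup)
import Data.Vec.Properties as VecP
open import Data.Vec.Functional using ([]; _∷_)
import Data.List.Properties as ListP
open import Data.Bool using (true; false; _∧_; if_then_else_)
open import Data.Empty using (⊥-elim)
open import Data.Product using (Σ; _×_; ∃; _,_)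
open import Data.Sum using (_⊎_; inj₁; inj₂)
open import Algebra.Bundles using (CommutativeRing)
import Algebra.Properties.Semiring.Sum
open import Relation.Nullary using (Dec; yes; no; ¬_)
open import Relation.Nullary.Decidable using (_⊎-dec_)
open import Relation.Binary.PropositionalEquality
open +-*-Solver using (solve; _:+_; _:*_; _:=_; con)

mono-*ˡ : ∀ {r p q} → 0ℚ ≤ r → p ≤ q → r * p ≤ r * q
mono-*ˡ {r} 0≤r = ℚP.*-monoˡ-≤-nonNeg r {{nonNegative 0≤r}}

mono-*ʳ : ∀ {r p q} → 0ℚ ≤ r → p ≤ q → p * r ≤ q * r
mono-*ʳ {r} 0≤r = ℚP.*-monoʳ-≤-nonNeg r {{nonNegative 0≤r}}

mono-* : ∀ {a b c d} → 0ℚ ≤ b → 0ℚ ≤ c → a ≤ c → b ≤ d → a * b ≤ c * d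
mono-* 0≤b 0≤c a≤c b≤d = ℚP.≤-trans (mono-*ʳ 0≤b a≤c) (mono-*ˡ 0≤c b≤d)

0≤* : ∀ {a b} → 0ℚ ≤ a → 0ℚ ≤ b → 0ℚ ≤ a * b
0≤* {a} 0≤a 0≤b = subst (_≤ a * _) (ℚP.*-zeroʳ a) (mono-*ˡ 0≤a 0≤b)

0≤+ : ∀ {a b} → 0ℚ ≤ a → 0ℚ ≤ b → 0ℚ ≤ a + b
0≤+ = ℚP.+-mono-≤

0<* : ∀ {a b} → 0ℚ < a → 0ℚ < b → 0ℚ < a * b
0<* {a} {b} 0<a 0<b = ℚP.positive⁻¹ _ {{ℚP.pos*pos⇒pos a {{positive 0<a}} b {{positive 0<b}}}}

0≤1 : 0ℚ ≤ 1ℚ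
0≤1 = ℚP.<⇒≤ (ℚP.positive⁻¹ 1ℚ)

≤+ʳ : ∀ {a b} → 0ℚ ≤ b → a ≤ a + b
≤+ʳ {a} 0≤b = subst (_≤ a + _) (ℚP.+-identityʳ a) (ℚP.+-monoʳ-≤ a 0≤b)

≤+ˡ : ∀ {a b} → 0ℚ ≤ a → b ≤ a + b
≤+ˡ {a} {b} 0≤a = subst (_≤ a + b) (ℚP.+-identityˡ b) (ℚP.+-monoˡ-≤ b 0≤a)

inv-inverseˡ : ∀ p → 0ℚ < p → inv p * p ≡ 1ℚ
inv-inverseˡ p 0<p with p ℚP.≟ 0ℚ
... | yes refl = ⊥-elim (ℚP.<-irrefl refl 0<p)
... | no p≢0 = ℚP.*-inverseˡ p {{≢-nonZero p≢0}}

inv-pos : ∀ p → 0ℚ < p → 0ℚ < inv p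
inv-pos p 0<p with p ℚP.≟ 0ℚ
... | yes refl = ⊥-elim (ℚP.<-irrefl refl 0<p)
... | no p≢0 = ℚP.positive⁻¹ _ {{ℚP.1/pos⇒pos p {{positive 0<p}}}}

inv-unique : ∀ {p q} → 0ℚ < p → p * q ≡ 1ℚ → inv p ≡ q
inv-unique {p} {q} 0<p pq≡1 = begin
  inv p              ≡⟨ sym (ℚP.*-identityʳ (inv p)) ⟩
  inv p * 1ℚ         ≡⟨ cong (inv p *_) (sym pq≡1) ⟩
  inv p * (p * q)    ≡⟨ sym (ℚP.*-assoc (inv p) p q) ⟩
  (inv p * p) * q    ≡⟨ cong (_* q) (inv-inverseˡ p 0<p) ⟩
  1ℚ * q             ≡⟨ ℚP.*-identityˡ q ⟩
  q                  ∎
  where open ≡-Reasoning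

1≤inv : ∀ {p} → 0ℚ < p → p ≤ 1ℚ → 1ℚ ≤ inv p
1≤inv {p} 0<p p≤1 = begin
  1ℚ          ≡⟨ sym (inv-inverseˡ p 0<p) ⟩
  inv p * p   ≤⟨ mono-*ˡ (ℚP.<⇒≤ (inv-pos p 0<p)) p≤1 ⟩
  inv p * 1ℚ  ≡⟨ ℚP.*-identityʳ (inv p) ⟩
  inv p       ∎
  where open ℚP.≤-Reasoning

^-distrib-* : ∀ a b n → (a * b) ^ n ≡ (a ^ n) * (b ^ n)
^-distrib-* a b zero = refl
^-distrib-* a b (suc n) = trans (cong ((a * b) *_) (^-distrib-* a b n))
  (solve 4 (λ a b c d → (a :* b) :* (c :* d) := (a :* c) :* (b :* d)) refl a b (a ^ n) (b ^ n))

1^n≡1 : ∀ n → 1ℚ ^ n ≡ 1ℚ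
1^n≡1 zero = refl
1^n≡1 (suc n) = trans (ℚP.*-identityˡ _) (1^n≡1 n)

^-nonNeg : ∀ {a} n → 0ℚ ≤ a → 0ℚ ≤ a ^ n
^-nonNeg zero 0≤a = 0≤1
^-nonNeg (suc n) 0≤a = 0≤* 0≤a (^-nonNeg n 0≤a)

^-pos : ∀ {a} n → 0ℚ < a → 0ℚ < a ^ n
^-pos zero 0<a = ℚP.positive⁻¹ 1ℚ
^-pos (suc n) 0<a = 0<* 0<a (^-pos n 0<a)

1≤^ : ∀ {a} n → 1ℚ ≤ a → 1ℚ ≤ a ^ n
1≤^ zero 1≤a = ℚP.≤-refl
1≤^ (suc n) 1≤a = mono-* 0≤1 (ℚP.≤-trans 0≤1 1≤a) 1≤a (1≤^ n 1≤a)

^-≤-suc : ∀ {a} n → 1ℚ ≤ a → a ^ n ≤ a ^ suc n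
^-≤-suc {a} n 1≤a = subst (_≤ a ^ suc n) (ℚP.*-identityˡ (a ^ n)) (mono-*ʳ (^-nonNeg n (ℚP.≤-trans 0≤1 1≤a)) 1≤a)

≤^suc : ∀ {a} n → 1ℚ ≤ a → a ≤ a ^ suc n
≤^suc {a} n 1≤a = subst (_≤ a ^ suc n) (ℚP.*-identityʳ a) (mono-*ˡ (ℚP.≤-trans 0≤1 1≤a) (1≤^ n 1≤a))

inv-^ : ∀ {b} n → 0ℚ < b → inv (b ^ n) ≡ inv b ^ n
inv-^ {b} n 0<b = inv-unique (^-pos n 0<b) (begin
  b ^ n * inv b ^ n    ≡⟨ sym (^-distrib-* b (inv b) n) ⟩
  (b * inv b) ^ n      ≡⟨ cong (_^ n) (trans (ℚP.*-comm b (inv b)) (inv-inverseˡ b 0<b)) ⟩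
  1ℚ ^ n               ≡⟨ 1^n≡1 n ⟩
  1ℚ                   ∎)
  where open ≡-Reasoning

fromℕ : ℕ → ℚ
fromℕ n = (+ n) / 1

fromℕ-+ : ∀ a b → fromℕ (a ℕ.+ b) ≡ fromℕ a + fromℕ b
fromℕ-+ a b = ℚP.toℚᵘ-injective (ℚᵘP.≃-trans (ℚP.toℚᵘ-fromℚᵘ (mkℚᵘ (+ (a ℕ.+ b)) 0))
  (ℚᵘP.≃-trans (*≡* eq) (ℚᵘP.≃-sym (ℚᵘP.≃-trans (ℚP.toℚᵘ-homo-+ (fromℕ a) (fromℕ b))
    (ℚᵘP.+-cong (ℚP.toℚᵘ-fromℚᵘ (mkℚᵘ (+ a) 0)) (ℚP.toℚᵘ-fromℚᵘ (mkℚᵘ (+ b) 0)))))))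
  where
  eq : (+ (a ℕ.+ b)) ℤ.* (+ 1) ≡ ((+ a) ℤ.* (+ 1) ℤ.+ (+ b) ℤ.* (+ 1)) ℤ.* (+ 1)
  eq rewrite ℤP.*-identityʳ (+ a) | ℤP.*-identityʳ (+ b) | ℤP.*-identityʳ (+ (a ℕ.+ b)) = refl

fromℕ-mono : ∀ {a b} → a ≤ℕ b → fromℕ a ≤ fromℕ b
fromℕ-mono {a} {b} a≤b = ℚP.toℚᵘ-cancel-≤
  (ℚᵘP.≤-respʳ-≃ (ℚᵘP.≃-sym (ℚP.toℚᵘ-fromℚᵘ (mkℚᵘ (+ b) 0)))
  (ℚᵘP.≤-respˡ-≃ (ℚᵘP.≃-sym (ℚP.toℚᵘ-fromℚᵘ (mkℚᵘ (+ a) 0)))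
  (*≤* (subst₂ ℤ._≤_ (sym (ℤP.*-identityʳ (+ a))) (sym (ℤP.*-identityʳ (+ b))) (ℤ.+≤+ a≤b)))))

0≤fromℕ : ∀ n → 0ℚ ≤ fromℕ n
0≤fromℕ n = fromℕ-mono (ℕ.z≤n {n})

/-as-* : ∀ a d .{{_ : NonZero d}} → (+ a) / d ≡ ((+ 1) / d) * fromℕ a
/-as-* a (suc d) = ℚP.toℚᵘ-injective
  (ℚᵘP.≃-trans (ℚP.toℚᵘ-fromℚᵘ (mkℚᵘ (+ a) d))
  (ℚᵘP.≃-trans (*≡* eq)
  (ℚᵘP.≃-sym (ℚᵘP.≃-trans (ℚP.toℚᵘ-homo-* ((+ 1) / suc d) (fromℕ a))
     (ℚᵘP.*-cong (ℚP.toℚᵘ-fromℚᵘ (mkℚᵘ (+ 1) d)) (ℚP.toℚᵘ-fromℚᵘ (mkℚᵘ (+ a) 0)))))))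
  where
  eq : (+ a) ℤ.* (+ suc (d ℕ.* 1)) ≡ ((+ 1) ℤ.* (+ a)) ℤ.* (+ suc d)
  eq rewrite ℕP.*-identityʳ d | ℤP.*-identityˡ (+ a) = refl

n/n≡1 : ∀ d .{{_ : NonZero d}} → (+ d) / d ≡ 1ℚ
n/n≡1 (suc d) = ℚP.toℚᵘ-injective (ℚᵘP.≃-trans (ℚP.toℚᵘ-fromℚᵘ (mkℚᵘ (+ suc d) d))
  (*≡* (ℤP.*-comm (+ suc d) (+ 1))))

-- Finite sums `sumF` of Defs agree with the library's `sum` over the semiring ℚ,
-- whose algebraic laws we then import.
module ∑ = Algebra.Properties.Semiring.Sum (CommutativeRing.semiring ℚP.+-*-commutativeRing)

sumF≡sum : ∀ {n} (f : Fin n → ℚ) → sumF f ≡ ∑.sum f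
sumF≡sum {zero} f = refl
sumF≡sum {suc n} f = cong (λ s → f zero + s) (sumF≡sum (λ i → f (suc i)))

sumF-cong : ∀ {n} {f g : Fin n → ℚ} → (∀ i → f i ≡ g i) → sumF f ≡ sumF g
sumF-cong {f = f} {g} f≗g = trans (sumF≡sum f) (trans (∑.sum-cong-≗ f≗g) (sym (sumF≡sum g)))

sumF-+ : ∀ {n} (f g : Fin n → ℚ) → sumF (λ i → f i + g i) ≡ sumF f + sumF g
sumF-+ f g = trans (sumF≡sum (λ i → f i + g i)) (trans (∑.∑-distrib-+ f g) (sym (cong₂ _+_ (sumF≡sum f) (sumF≡sum g))))

sumF-*ˡ : ∀ {n} a (f : Fin n → ℚ) → sumF (λ i → a * f i) ≡ a * sumF f
sumF-*ˡ a f = trans (sumF≡sum (λ i → a * f i)) (trans (sym (∑.*-distribˡ-sum a f)) (sym (cong (a *_) (sumF≡sum f))))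

sumF-*ʳ : ∀ {n} a (f : Fin n → ℚ) → sumF (λ i → f i * a) ≡ sumF f * a
sumF-*ʳ a f = trans (sumF≡sum (λ i → f i * a)) (trans (sym (∑.*-distribʳ-sum a f)) (sym (cong (_* a) (sumF≡sum f))))

sumF-comm : ∀ {m n} (f : Fin m → Fin n → ℚ) →
  sumF (λ i → sumF (λ j → f i j)) ≡ sumF (λ j → sumF (λ i → f i j))
sumF-comm f = begin
  sumF (λ i → sumF (f i))              ≡⟨ sumF-cong (λ i → sumF≡sum (f i)) ⟩
  sumF (λ i → ∑.sum (f i))             ≡⟨ sumF≡sum (λ i → ∑.sum (f i)) ⟩
  ∑.sum (λ i → ∑.sum (f i))            ≡⟨ ∑.∑-comm f ⟩
  ∑.sum (λ j → ∑.sum (λ i → f i j))    ≡⟨ sym (sumF≡sum (λ j → ∑.sum (λ i → f i j))) ⟩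
  sumF (λ j → ∑.sum (λ i → f i j))     ≡⟨ sumF-cong (λ j → sym (sumF≡sum (λ i → f i j))) ⟩
  sumF (λ j → sumF (λ i → f i j))      ∎
  where open ≡-Reasoning

sumF-reindex : ∀ {n} (f : Fin n → ℚ) (σ τ : Fin n → Fin n) →
  (∀ x → σ (τ x) ≡ x) → (∀ x → τ (σ x) ≡ x) → sumF (λ i → f (σ i)) ≡ sumF f
sumF-reindex f σ τ στ τσ = trans (sumF≡sum (λ i → f (σ i)))
  (trans (sym (∑.sum-permute f (permutation σ τ στ τσ))) (sym (sumF≡sum f)))

sumF-const : ∀ n a → sumF {n} (λ _ → a) ≡ fromℕ n * a
sumF-const zero a = sym (ℚP.*-zeroˡ a)
sumF-const (suc n) a = begin
  a + sumF {n} (λ _ → a)        ≡⟨ cong (λ s → a + s) (sumF-const n a) ⟩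
  a + fromℕ n * a               ≡⟨ solve 2 (λ a c → a :+ c :* a := (con 1ℚ :+ c) :* a) refl a (fromℕ n) ⟩
  (1ℚ + fromℕ n) * a            ≡⟨ cong (_* a) (sym (fromℕ-+ 1 n)) ⟩
  fromℕ (suc n) * a             ∎
  where open ≡-Reasoning

sumF-mono : ∀ {n} {f g : Fin n → ℚ} → (∀ i → f i ≤ g i) → sumF f ≤ sumF g
sumF-mono {zero} f≤g = ℚP.≤-refl
sumF-mono {suc n} f≤g = ℚP.+-mono-≤ (f≤g zero) (sumF-mono (λ i → f≤g (suc i)))

sumF-nonNeg : ∀ {n} {f : Fin n → ℚ} → (∀ i → 0ℚ ≤ f i) → 0ℚ ≤ sumF f
sumF-nonNeg {zero} 0≤f = ℚP.≤-refl
sumF-nonNeg {suc n} 0≤f = 0≤+ (0≤f zero) (sumF-nonNeg (λ i → 0≤f (suc i)))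

term≤sumF : ∀ {n} (f : Fin n → ℚ) → (∀ i → 0ℚ ≤ f i) → ∀ i → f i ≤ sumF f
term≤sumF f 0≤f zero = ≤+ʳ (sumF-nonNeg (λ i → 0≤f (suc i)))
term≤sumF f 0≤f (suc i) = ℚP.≤-trans (term≤sumF (λ j → f (suc j)) (λ j → 0≤f (suc j)) i) (≤+ˡ (0≤f zero))

-- Indicator functions of subsets of Fin n; `ind` of Defs is this function on Fin P.
indicator : ∀ {n} → Subset n → Fin n → ℚ
indicator S x = if lookup S x then 1ℚ else 0ℚ

indicator-nonNeg : ∀ {n} (S : Subset n) x → 0ℚ ≤ indicator S x
indicator-nonNeg S x with lookup S x
... | true = 0≤1
... | false = ℚP.≤-refl

indicator-≤1 : ∀ {n} (S : Subset n) x → indicator S x ≤ 1ℚ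
indicator-≤1 S x with lookup S x
... | true = ℚP.≤-refl
... | false = 0≤1

indicator-∈ : ∀ {n} (S : Subset n) {x} → x ∈ S → indicator S x ≡ 1ℚ
indicator-∈ S x∈S rewrite VecP.[]=⇒lookup x∈S = refl

indicator-∩ : ∀ {n} (S T : Subset n) x → indicator (S ∩ T) x ≡ indicator S x * indicator T x
indicator-∩ S T x rewrite VecP.lookup-zipWith _∧_ x S T with lookup S x
... | true = sym (ℚP.*-identityˡ (indicator T x))
... | false = sym (ℚP.*-zeroˡ (indicator T x))

sumF-indicator : ∀ {n} (S : Subset n) → sumF (indicator S) ≡ fromℕ ∣ S ∣
sumF-indicator Vec.[] = refl
sumF-indicator (true Vec.∷ S) = trans (cong (λ s → 1ℚ + s) (sumF-indicator S)) (sym (fromℕ-+ 1 ∣ S ∣))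
sumF-indicator (false Vec.∷ S) = trans (ℚP.+-identityˡ _) (sumF-indicator S)

-- Additive structure of ℤ/Pℤ as needed: translations y ↦ y - a and reflections
-- y ↦ a - y are bijections, so they leave sums over ℤ/Pℤ unchanged.
module ZMod {P : ℕ} .{{_ : NonZero P}} where
  open ≡-Reasoning

  %-absorbˡ : ∀ a b → ((a % P) ℕ.+ b) % P ≡ (a ℕ.+ b) % P
  %-absorbˡ a b = begin
    ((a % P) ℕ.+ b) % P              ≡⟨ %-distribˡ-+ (a % P) b P ⟩
    ((a % P % P) ℕ.+ (b % P)) % P    ≡⟨ cong (λ z → (z ℕ.+ (b % P)) % P) (m%n%n≡m%n a P) ⟩
    ((a % P) ℕ.+ (b % P)) % P        ≡⟨ sym (%-distribˡ-+ a b P) ⟩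
    (a ℕ.+ b) % P                    ∎

  %-absorbʳ : ∀ a b → (a ℕ.+ (b % P)) % P ≡ (a ℕ.+ b) % P
  %-absorbʳ a b = begin
    (a ℕ.+ (b % P)) % P   ≡⟨ cong (_% P) (ℕP.+-comm a (b % P)) ⟩
    ((b % P) ℕ.+ a) % P   ≡⟨ %-absorbˡ b a ⟩
    (b ℕ.+ a) % P         ≡⟨ cong (_% P) (ℕP.+-comm b a) ⟩
    (a ℕ.+ b) % P         ∎

  toℕ-⊕ : (x y : Fin P) → toℕ (x ⊕ y) ≡ (toℕ x ℕ.+ toℕ y) % P
  toℕ-⊕ x y = FinP.toℕ-fromℕ< _

  toℕ-⊝ : (x y : Fin P) → toℕ (x ⊝ y) ≡ (toℕ x ℕ.+ (P ℕ.∸ toℕ y)) % P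
  toℕ-⊝ x y = trans (toℕ-⊕ x (⊖ y)) (trans (cong (λ z → (toℕ x ℕ.+ z) % P) (FinP.toℕ-fromℕ< _))
    (%-absorbʳ (toℕ x) (P ℕ.∸ toℕ y)))

  toℕ-%P : (x : Fin P) → toℕ x % P ≡ toℕ x
  toℕ-%P x = m<n⇒m%n≡m (FinP.toℕ<n x)

  ⊕-comm : (x y : Fin P) → x ⊕ y ≡ y ⊕ x
  ⊕-comm x y = FinP.toℕ-injective (begin
    toℕ (x ⊕ y)                  ≡⟨ toℕ-⊕ x y ⟩
    (toℕ x ℕ.+ toℕ y) % P        ≡⟨ cong (_% P) (ℕP.+-comm (toℕ x) (toℕ y)) ⟩
    (toℕ y ℕ.+ toℕ x) % P        ≡⟨ sym (toℕ-⊕ y x) ⟩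
    toℕ (y ⊕ x)                  ∎)

  ⊝-⊕-cancel : (n y : Fin P) → (n ⊝ y) ⊕ y ≡ n
  ⊝-⊕-cancel n y = FinP.toℕ-injective (begin
    toℕ ((n ⊝ y) ⊕ y)                                      ≡⟨ toℕ-⊕ (n ⊝ y) y ⟩
    (toℕ (n ⊝ y) ℕ.+ toℕ y) % P                            ≡⟨ cong (λ z → (z ℕ.+ toℕ y) % P) (toℕ-⊝ n y) ⟩
    (((toℕ n ℕ.+ (P ℕ.∸ toℕ y)) % P) ℕ.+ toℕ y) % P        ≡⟨ %-absorbˡ _ (toℕ y) ⟩
    (toℕ n ℕ.+ (P ℕ.∸ toℕ y) ℕ.+ toℕ y) % P                ≡⟨ cong (_% P) (ℕP.+-assoc (toℕ n) _ (toℕ y)) ⟩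
    (toℕ n ℕ.+ ((P ℕ.∸ toℕ y) ℕ.+ toℕ y)) % P              ≡⟨ cong (λ z → (toℕ n ℕ.+ z) % P) (ℕP.m∸n+n≡m y≤P) ⟩
    (toℕ n ℕ.+ P) % P                                      ≡⟨ [m+n]%n≡m%n (toℕ n) P ⟩
    toℕ n % P                                              ≡⟨ toℕ-%P n ⟩
    toℕ n                                                  ∎)
    where y≤P = ℕP.<⇒≤ (FinP.toℕ<n y)

  ⊕-⊝-cancel : (n y : Fin P) → (n ⊕ y) ⊝ y ≡ n
  ⊕-⊝-cancel n y = FinP.toℕ-injective (begin
    toℕ ((n ⊕ y) ⊝ y)                                      ≡⟨ toℕ-⊝ (n ⊕ y) y ⟩
    (toℕ (n ⊕ y) ℕ.+ (P ℕ.∸ toℕ y)) % P                    ≡⟨ cong (λ z → (z ℕ.+ (P ℕ.∸ toℕ y)) % P) (toℕ-⊕ n y) ⟩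
    ((toℕ n ℕ.+ toℕ y) % P ℕ.+ (P ℕ.∸ toℕ y)) % P          ≡⟨ %-absorbˡ _ _ ⟩
    (toℕ n ℕ.+ toℕ y ℕ.+ (P ℕ.∸ toℕ y)) % P                ≡⟨ cong (_% P) (ℕP.+-assoc (toℕ n) (toℕ y) _) ⟩
    (toℕ n ℕ.+ (toℕ y ℕ.+ (P ℕ.∸ toℕ y))) % P              ≡⟨ cong (λ z → (toℕ n ℕ.+ z) % P) (ℕP.m+[n∸m]≡n y≤P) ⟩
    (toℕ n ℕ.+ P) % P                                      ≡⟨ [m+n]%n≡m%n (toℕ n) P ⟩
    toℕ n % P                                              ≡⟨ toℕ-%P n ⟩
    toℕ n                                                  ∎)
    where y≤P = ℕP.<⇒≤ (FinP.toℕ<n y)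

  -- a - (a - x) = x, since a = (a - x) + x.
  ⊝-involutive : (a x : Fin P) → a ⊝ (a ⊝ x) ≡ x
  ⊝-involutive a x = begin
    a ⊝ u          ≡⟨ cong (_⊝ u) (sym (⊝-⊕-cancel a x)) ⟩
    (u ⊕ x) ⊝ u    ≡⟨ cong (_⊝ u) (⊕-comm u x) ⟩
    (x ⊕ u) ⊝ u    ≡⟨ ⊕-⊝-cancel x u ⟩
    x              ∎
    where u = a ⊝ x

  sumF-translate : (f : Fin P → ℚ) (a : Fin P) → sumF (λ y → f (y ⊝ a)) ≡ sumF f
  sumF-translate f a = sumF-reindex f (_⊝ a) (_⊕ a) (λ y → ⊕-⊝-cancel y a) (λ y → ⊝-⊕-cancel y a)

  sumF-reflect : (f : Fin P → ℚ) (a : Fin P) → sumF (λ y → f (a ⊝ y)) ≡ sumF f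
  sumF-reflect f a = sumF-reindex f (a ⊝_) (a ⊝_) (⊝-involutive a) (⊝-involutive a)

module Density {P : ℕ} .{{_ : NonZero P}} where
  1/P : ℚ
  1/P = (+ 1) / P

  0<1/P : 0ℚ < 1/P
  0<1/P = ℚP.positive⁻¹ 1/P {{ℚP.normalize-pos 1 P}}

  dens-as-sum : (S : Subset P) → dens S ≡ 1/P * fromℕ ∣ S ∣
  dens-as-sum S = /-as-* ∣ S ∣ P

  dens-pos : (S : Subset P) → 0ℚ < fromℕ ∣ S ∣ → 0ℚ < dens S
  dens-pos S 0<|S| = subst (0ℚ <_) (sym (dens-as-sum S)) (0<* 0<1/P 0<|S|)

  1≤∣∣ : (S : Subset P) → Nonempty S → 1ℚ ≤ fromℕ ∣ S ∣
  1≤∣∣ S (x , x∈S) = subst₂ _≤_ (indicator-∈ S x∈S) (sumF-indicator S)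
    (term≤sumF (indicator S) (indicator-nonNeg S) x)

open Density

module Moments {P : ℕ} .{{_ : NonZero P}} (C B : Subset P) where
  open ZMod

  M : Fin P → ℚ
  M n = sumF (λ y → ind C (n ⊝ y) * ind B y)

  M-nonNeg : ∀ n → 0ℚ ≤ M n
  M-nonNeg n = sumF-nonNeg (λ y → 0≤* (indicator-nonNeg C (n ⊝ y)) (indicator-nonNeg B y))

  w : ∀ {k} → (Fin k → Fin P) → Fin P → ℚ
  w g = ind (interShifts C g)

  w-nil : ∀ n → w [] n ≡ 1ℚ
  w-nil n = cong (λ b → if b then 1ℚ else 0ℚ) (VecP.lookup-replicate n true)

  interShifts-cons : ∀ {k} y (g : Fin k → Fin P) → interShifts C (y ∷ g) ≡ shift C y ∩ interShifts C g
  interShifts-cons y g = cong (λ L → shift C y ∩ ⋂ L)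
    (trans (ListP.map-tabulate suc (λ i → shift C ((y ∷ g) i)))
           (sym (ListP.map-tabulate (λ i → i) (λ i → shift C (g i)))))

  w-cons : ∀ {k} y (g : Fin k → Fin P) n → w (y ∷ g) n ≡ ind C (n ⊝ y) * w g n
  w-cons y g n = begin
    ind (interShifts C (y ∷ g)) n            ≡⟨ cong (λ S → ind S n) (interShifts-cons y g) ⟩
    ind (shift C y ∩ interShifts C g) n      ≡⟨ indicator-∩ (shift C y) (interShifts C g) n ⟩
    ind (shift C y) n * w g n                ≡⟨ cong (λ b → (if b then 1ℚ else 0ℚ) * w g n)
                                                     (VecP.lookup∘tabulate (λ x → lookup C (x ⊝ y)) n) ⟩
    ind C (n ⊝ y) * w g n                    ∎
    where open ≡-Reasoning

  moment : ∀ {k} → (Fin k → Fin P) → ℕ → ℚ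
  moment g m = 1/P * sumF (λ n → w g n * M n ^ m)

  moment-nonNeg : ∀ {k} (g : Fin k → Fin P) m → 0ℚ ≤ moment g m
  moment-nonNeg g m = 0≤* (ℚP.<⇒≤ 0<1/P)
    (sumF-nonNeg (λ n → 0≤* (indicator-nonNeg (interShifts C g) n) (^-nonNeg m (M-nonNeg n))))

  -- Adding a shift shrinks the intersection, hence the moment.
  moment-cons≤ : ∀ {k} y (g : Fin k → Fin P) m → moment (y ∷ g) m ≤ moment g m
  moment-cons≤ y g m = mono-*ˡ (ℚP.<⇒≤ 0<1/P) (sumF-mono λ n →
    mono-*ʳ (^-nonNeg m (M-nonNeg n)) (subst₂ _≤_ (sym (w-cons y g n)) (ℚP.*-identityˡ (w g n))
      (mono-*ʳ (indicator-nonNeg (interShifts C g) n) (indicator-≤1 C (n ⊝ y)))))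

  moment-zero : ∀ {k} (g : Fin k → Fin P) → moment g 0 ≡ dens (interShifts C g)
  moment-zero g = begin
    1/P * sumF (λ n → w g n * 1ℚ)       ≡⟨ cong (1/P *_) (sumF-cong (λ n → ℚP.*-identityʳ (w g n))) ⟩
    1/P * sumF (w g)                    ≡⟨ cong (1/P *_) (sumF-indicator (interShifts C g)) ⟩
    1/P * fromℕ ∣ interShifts C g ∣     ≡⟨ sym (dens-as-sum (interShifts C g)) ⟩
    dens (interShifts C g)              ∎
    where open ≡-Reasoning

  -- Expanding one factor M(n) = Σ_y 1_C(n - y) 1_B(y) adds the shift y to the tuple.
  moment-suc : ∀ {k} (g : Fin k → Fin P) m → moment g (suc m) ≡ sumF (λ y → ind B y * moment (y ∷ g) m)
  moment-suc g m = begin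
    1/P * sumF (λ n → w g n * (M n * M n ^ m))
      ≡⟨ cong (1/P *_) (sumF-cong expand) ⟩
    1/P * sumF (λ n → sumF (λ y → ind B y * (w (y ∷ g) n * M n ^ m)))
      ≡⟨ cong (1/P *_) (sumF-comm (λ n y → ind B y * (w (y ∷ g) n * M n ^ m))) ⟩
    1/P * sumF (λ y → sumF (λ n → ind B y * (w (y ∷ g) n * M n ^ m)))
      ≡⟨ cong (1/P *_) (sumF-cong (λ y → sumF-*ˡ (ind B y) (λ n → w (y ∷ g) n * M n ^ m))) ⟩
    1/P * sumF (λ y → ind B y * sumF (λ n → w (y ∷ g) n * M n ^ m))
      ≡⟨ sym (sumF-*ˡ 1/P (λ y → ind B y * sumF (λ n → w (y ∷ g) n * M n ^ m))) ⟩
    sumF (λ y → 1/P * (ind B y * sumF (λ n → w (y ∷ g) n * M n ^ m)))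
      ≡⟨ sumF-cong (λ y → solve 3 (λ a b c → a :* (b :* c) := b :* (a :* c)) refl 1/P (ind B y) _) ⟩
    sumF (λ y → ind B y * moment (y ∷ g) m)  ∎
    where
    open ≡-Reasoning
    expand : ∀ n → w g n * (M n * M n ^ m) ≡ sumF (λ y → ind B y * (w (y ∷ g) n * M n ^ m))
    expand n = begin
      w g n * (M n * M n ^ m)
        ≡⟨ solve 3 (λ a b c → a :* (b :* c) := b :* (a :* c)) refl (w g n) (M n) (M n ^ m) ⟩
      M n * (w g n * M n ^ m)
        ≡⟨ ℚP.*-comm (M n) _ ⟩
      (w g n * M n ^ m) * M n
        ≡⟨ sym (sumF-*ˡ (w g n * M n ^ m) (λ y → ind C (n ⊝ y) * ind B y)) ⟩
      sumF (λ y → (w g n * M n ^ m) * (ind C (n ⊝ y) * ind B y))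
        ≡⟨ sumF-cong (λ y → trans (solve 4 (λ a r c b → (a :* r) :* (c :* b) := b :* ((c :* a) :* r)) refl
                               (w g n) (M n ^ m) (ind C (n ⊝ y)) (ind B y))
                             (cong (λ z → ind B y * (z * M n ^ m)) (sym (w-cons y g n)))) ⟩
      sumF (λ y → ind B y * (w (y ∷ g) n * M n ^ m))  ∎

  moment-nil-zero : (g : Fin 0 → Fin P) → moment g 0 ≡ 1ℚ
  moment-nil-zero g = trans (moment-zero g) (trans (cong (λ s → (+ s) / P) (∣⊤∣≡n P)) (n/n≡1 P))

  moment-single-zero : (g : Fin 1 → Fin P) → moment g 0 ≡ dens C
  moment-single-zero g = begin
    1/P * sumF (λ n → w g n * 1ℚ)           ≡⟨ cong (1/P *_) (sumF-cong single) ⟩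
    1/P * sumF (λ n → ind C (n ⊝ y))        ≡⟨ cong (1/P *_) (sumF-translate (ind C) y) ⟩
    1/P * sumF (ind C)                      ≡⟨ cong (1/P *_) (sumF-indicator C) ⟩
    1/P * fromℕ ∣ C ∣                       ≡⟨ sym (dens-as-sum C) ⟩
    dens C                                  ∎
    where
    open ≡-Reasoning
    y = g zero
    single : ∀ n → w g n * 1ℚ ≡ ind C (n ⊝ y)
    single n = trans (ℚP.*-identityʳ _) (trans (w-cons y [] n)
                 (trans (cong (ind C (n ⊝ y) *_) (w-nil n)) (ℚP.*-identityʳ _)))

  D : ℚ
  D = dens C * fromℕ ∣ B ∣

  0<D : 0ℚ < dens C → 0ℚ < fromℕ ∣ B ∣ → 0ℚ < D
  0<D = 0<*

  conv-fSet : 0ℚ < dens C → 0ℚ < fromℕ ∣ B ∣ → ∀ n → conv (fSet C) (fSet B) n ≡ inv D * M n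
  conv-fSet 0<dC 0<|B| n = begin
    1/P * sumF (λ y → (iC * ind C (n ⊝ y)) * (iB * ind B y))
      ≡⟨ cong (1/P *_) (sumF-cong (λ y → solve 4 (λ a c b d → (a :* c) :* (b :* d) := (a :* b) :* (c :* d))
                                            refl iC (ind C (n ⊝ y)) iB (ind B y))) ⟩
    1/P * sumF (λ y → (iC * iB) * (ind C (n ⊝ y) * ind B y))
      ≡⟨ cong (1/P *_) (sumF-*ˡ (iC * iB) (λ y → ind C (n ⊝ y) * ind B y)) ⟩
    1/P * ((iC * iB) * M n)
      ≡⟨ sym (ℚP.*-assoc 1/P (iC * iB) (M n)) ⟩
    (1/P * (iC * iB)) * M n
      ≡⟨ cong (_* M n) (sym (inv-unique (0<D 0<dC 0<|B|) D*K≡1)) ⟩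
    inv D * M n  ∎
    where
    open ≡-Reasoning
    iC = inv (dens C)
    iB = inv (dens B)
    D*K≡1 : D * (1/P * (iC * iB)) ≡ 1ℚ
    D*K≡1 = begin
      dens C * fromℕ ∣ B ∣ * (1/P * (iC * iB))
        ≡⟨ solve 5 (λ d b p c e → d :* b :* (p :* (c :* e)) := (c :* d) :* (e :* (p :* b))) refl
                   (dens C) (fromℕ ∣ B ∣) 1/P iC iB ⟩
      (iC * dens C) * (iB * (1/P * fromℕ ∣ B ∣))
        ≡⟨ cong₂ (λ u v → u * (iB * v)) (inv-inverseˡ (dens C) 0<dC) (sym (dens-as-sum B)) ⟩
      1ℚ * (iB * dens B)
        ≡⟨ trans (ℚP.*-identityˡ _) (inv-inverseˡ (dens B) (dens-pos B 0<|B|)) ⟩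
      1ℚ  ∎

  normPow-conv : 0ℚ < dens C → 0ℚ < fromℕ ∣ B ∣ → ∀ l →
    normPow l (conv (fSet C) (fSet B)) ≡ inv D ^ l * moment [] l
  normPow-conv 0<dC 0<|B| l = begin
    1/P * sumF (λ n → abs (conv (fSet C) (fSet B) n) ^ l)
      ≡⟨ cong (1/P *_) (sumF-cong term) ⟩
    1/P * sumF (λ n → inv D ^ l * (w [] n * M n ^ l))
      ≡⟨ cong (1/P *_) (sumF-*ˡ (inv D ^ l) (λ n → w [] n * M n ^ l)) ⟩
    1/P * (inv D ^ l * sumF (λ n → w [] n * M n ^ l))
      ≡⟨ solve 3 (λ a b c → a :* (b :* c) := b :* (a :* c)) refl 1/P (inv D ^ l) _ ⟩
    inv D ^ l * moment [] l  ∎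
    where
    open ≡-Reasoning
    0≤F : ∀ n → 0ℚ ≤ inv D * M n
    0≤F n = 0≤* (ℚP.<⇒≤ (inv-pos D (0<D 0<dC 0<|B|))) (M-nonNeg n)
    term : ∀ n → abs (conv (fSet C) (fSet B) n) ^ l ≡ inv D ^ l * (w [] n * M n ^ l)
    term n = begin
      abs (conv (fSet C) (fSet B) n) ^ l   ≡⟨ cong (λ z → abs z ^ l) (conv-fSet 0<dC 0<|B| n) ⟩
      abs (inv D * M n) ^ l                ≡⟨ cong (_^ l) (ℚP.0≤p⇒∣p∣≡p (0≤F n)) ⟩
      (inv D * M n) ^ l                    ≡⟨ ^-distrib-* (inv D) (M n) l ⟩
      inv D ^ l * M n ^ l                  ≡⟨ cong (λ z → inv D ^ l * z) (sym (trans (cong (_* M n ^ l) (w-nil n)) (ℚP.*-identityˡ _))) ⟩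
      inv D ^ l * (w [] n * M n ^ l)       ∎

module Separation {P : ℕ} .{{_ : NonZero P}} (S' : Subset P) where
  open ZMod

  Separated : ∀ {k} → (Fin k → Fin P) → Set
  Separated g = ∀ i j → i ≢ j → (g i ⊝ g j) ∉ S'

  Near : ∀ {k} → (Fin k → Fin P) → Fin P → Set
  Near g y = ∃ λ i → (y ⊝ g i) ∈ S' ⊎ (g i ⊝ y) ∈ S'

  near? : ∀ {k} (g : Fin k → Fin P) y → Dec (Near g y)
  near? g y = FinP.any? (λ i → ((y ⊝ g i) ∈? S') ⊎-dec ((g i ⊝ y) ∈? S'))

  separated-cons : ∀ {k} (g : Fin k → Fin P) y → Separated g → ¬ Near g y → Separated (y ∷ g)
  separated-cons g y sep far zero zero 0≢0 = ⊥-elim (0≢0 refl)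
  separated-cons g y sep far zero (suc j) _ y-gⱼ∈S' = far (j , inj₁ y-gⱼ∈S')
  separated-cons g y sep far (suc i) zero _ gᵢ-y∈S' = far (i , inj₂ gᵢ-y∈S')
  separated-cons g y sep far (suc i) (suc j) i≢j = sep i j (λ i≡j → i≢j (cong suc i≡j))

  nearness : ∀ {k} → (Fin k → Fin P) → Fin P → ℚ
  nearness g y = sumF (λ i → ind S' (y ⊝ g i) + ind S' (g i ⊝ y))

  nearness-nonNeg : ∀ {k} (g : Fin k → Fin P) y → 0ℚ ≤ nearness g y
  nearness-nonNeg g y = sumF-nonNeg (λ i → 0≤+ (indicator-nonNeg S' (y ⊝ g i)) (indicator-nonNeg S' (g i ⊝ y)))

  1≤nearness : ∀ {k} (g : Fin k → Fin P) y → Near g y → 1ℚ ≤ nearness g y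
  1≤nearness g y (i , near) = ℚP.≤-trans (1≤term near)
    (term≤sumF _ (λ j → 0≤+ (indicator-nonNeg S' (y ⊝ g j)) (indicator-nonNeg S' (g j ⊝ y))) i)
    where
    1≤term : (y ⊝ g i) ∈ S' ⊎ (g i ⊝ y) ∈ S' → 1ℚ ≤ ind S' (y ⊝ g i) + ind S' (g i ⊝ y)
    1≤term (inj₁ ∈S') = subst (λ a → 1ℚ ≤ a + ind S' (g i ⊝ y)) (sym (indicator-∈ S' ∈S')) (≤+ʳ (indicator-nonNeg S' (g i ⊝ y)))
    1≤term (inj₂ ∈S') = subst (λ b → 1ℚ ≤ ind S' (y ⊝ g i) + b) (sym (indicator-∈ S' ∈S')) (≤+ˡ (indicator-nonNeg S' (y ⊝ g i)))

  -- Each coordinate is near exactly 2|S'| shifts (with multiplicity).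
  sumF-nearness : ∀ {k} (g : Fin k → Fin P) → sumF (nearness g) ≡ fromℕ k * ((fromℕ ∣ S' ∣) + (fromℕ ∣ S' ∣))
  sumF-nearness {k} g = begin
    sumF (λ y → sumF (λ i → ind S' (y ⊝ g i) + ind S' (g i ⊝ y)))
      ≡⟨ sumF-comm (λ y i → ind S' (y ⊝ g i) + ind S' (g i ⊝ y)) ⟩
    sumF (λ i → sumF (λ y → ind S' (y ⊝ g i) + ind S' (g i ⊝ y)))
      ≡⟨ sumF-cong (λ i → trans (sumF-+ (λ y → ind S' (y ⊝ g i)) (λ y → ind S' (g i ⊝ y)))
                                (cong₂ _+_ (sumF-translate (ind S') (g i)) (sumF-reflect (ind S') (g i)))) ⟩
    sumF {k} (λ _ → sumF (ind S') + sumF (ind S'))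
      ≡⟨ sumF-const k _ ⟩
    fromℕ k * (sumF (ind S') + sumF (ind S'))
      ≡⟨ cong (λ s → fromℕ k * (s + s)) (sumF-indicator S') ⟩
    fromℕ k * ((fromℕ ∣ S' ∣) + (fromℕ ∣ S' ∣))  ∎
    where open ≡-Reasoning

-- The constants. c₀ k is the constant of the k-fold intersection hypothesis (the
-- trivial value 1 for k ≤ 1). momentConst k m bounds the m-th moment of a separated
-- k-tuple: each further shift either keeps the tuple separated (k ↦ k + 1) or is
-- near one of the k shifts, which happens for at most 2kt shifts.
c₀ : (ℕ → ℚ) → ℕ → ℚ
c₀ cl (suc (suc k)) = cl (suc (suc k))
c₀ cl _ = 1ℚ

momentConst : (ℕ → ℚ) → ℕ → ℕ → ℕ → ℚ
momentConst cl t k zero = c₀ cl k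
momentConst cl t k (suc m) =
  fromℕ k * (fromℕ t + fromℕ t) * momentConst cl t k m + momentConst cl t (suc k) m

module _ (cl : ℕ → ℚ) (cl-pos : ∀ l → 2 ≤ℕ l → 0ℚ < cl l) where
  0≤c₀ : ∀ k → 0ℚ ≤ c₀ cl k
  0≤c₀ zero = 0≤1
  0≤c₀ (suc zero) = 0≤1
  0≤c₀ (suc (suc k)) = ℚP.<⇒≤ (cl-pos (suc (suc k)) (ℕ.s≤s (ℕ.s≤s ℕ.z≤n)))

  0≤momentConst : ∀ t k m → 0ℚ ≤ momentConst cl t k m
  0≤momentConst t k zero = 0≤c₀ k
  0≤momentConst t k (suc m) = 0≤+
    (0≤* (0≤* (0≤fromℕ k) (0≤+ (0≤fromℕ t) (0≤fromℕ t))) (0≤momentConst t k m))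
    (0≤momentConst t (suc k) m)

-- The moment bound under the hypotheses of the theorem. With x = 1/β, a = x·d(C) and e = x·d(C)|B|:
--   moment g m ≤ momentConst k m · a^k · e^m   for every separated k-tuple g.
module MomentBound
  (cl : ℕ → ℚ) (cl-pos : ∀ l → 2 ≤ℕ l → 0ℚ < cl l) (t : ℕ)
  {P : ℕ} .{{_ : NonZero P}} (C : Subset P) (C≢∅ : Nonempty C)
  (S' : Subset P) (|S'|≤t : ∣ S' ∣ ≤ℕ t)
  (β : ℚ) (0<β : 0ℚ < β) (β≤1 : β ≤ 1ℚ)
  (intersection-bound : ∀ k → 2 ≤ℕ k → (h : Fin k → Fin P) →
     (∀ i j → i ≢ j → (h i ⊝ h j) ∉ S') →
     dens (interShifts C h) ≤ cl k * inv (β ^ k) * (dens C ^ k))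
  (B : Subset P) (B-large : inv (dens C) ≤ fromℕ ∣ B ∣) where

  open Moments C B
  open Separation S'
  open ℚP.≤-Reasoning

  V : ℕ → ℕ → ℚ
  V = momentConst cl t

  x a e : ℚ
  x = inv β
  a = x * dens C
  e = x * D

  Bound : ℕ → ℕ → ℚ
  Bound k m = V k m * a ^ k * e ^ m

  1≤x : 1ℚ ≤ x
  1≤x = 1≤inv 0<β β≤1

  0<dC : 0ℚ < dens C
  0<dC = dens-pos C (ℚP.<-≤-trans (ℚP.positive⁻¹ 1ℚ) (1≤∣∣ C C≢∅))

  0<|B| : 0ℚ < fromℕ ∣ B ∣
  0<|B| = ℚP.<-≤-trans (inv-pos (dens C) 0<dC) B-large

  1≤D : 1ℚ ≤ D
  1≤D = begin
    1ℚ                   ≡⟨ sym (inv-inverseˡ (dens C) 0<dC) ⟩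
    inv (dens C) * dens C ≡⟨ ℚP.*-comm (inv (dens C)) (dens C) ⟩
    dens C * inv (dens C) ≤⟨ mono-*ˡ (ℚP.<⇒≤ 0<dC) B-large ⟩
    D                    ∎

  0≤x : 0ℚ ≤ x
  0≤x = ℚP.≤-trans 0≤1 1≤x

  0≤a : 0ℚ ≤ a
  0≤a = 0≤* 0≤x (ℚP.<⇒≤ 0<dC)

  1≤e : 1ℚ ≤ e
  1≤e = mono-* 0≤1 0≤x 1≤x 1≤D

  0≤e : 0ℚ ≤ e
  0≤e = ℚP.≤-trans 0≤1 1≤e

  0≤Bound : ∀ k m → 0ℚ ≤ Bound k m
  0≤Bound k m = 0≤* (0≤* (0≤momentConst cl cl-pos t k m) (^-nonNeg k 0≤a)) (^-nonNeg m 0≤e)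

  base : ∀ k (g : Fin k → Fin P) → Separated g → moment g 0 ≤ Bound k 0
  base zero g _ = ℚP.≤-reflexive (moment-nil-zero g)
  base (suc zero) g _ = begin
    moment g 0                      ≡⟨ moment-single-zero g ⟩
    dens C                          ≡⟨ sym (ℚP.*-identityˡ (dens C)) ⟩
    1ℚ * dens C                     ≤⟨ mono-*ʳ (ℚP.<⇒≤ 0<dC) 1≤x ⟩
    a                               ≡⟨ solve 1 (λ a → a := con 1ℚ :* (a :* con 1ℚ) :* con 1ℚ) refl a ⟩
    Bound 1 0                       ∎
  base (suc (suc k)) g sep = begin
    moment g 0                                  ≡⟨ moment-zero g ⟩
    dens (interShifts C g)                      ≤⟨ intersection-bound K (ℕ.s≤s (ℕ.s≤s ℕ.z≤n)) g sep ⟩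
    cl K * inv (β ^ K) * (dens C ^ K)           ≡⟨ cong (λ z → cl K * z * (dens C ^ K)) (inv-^ K 0<β) ⟩
    cl K * x ^ K * (dens C ^ K)                 ≡⟨ ℚP.*-assoc (cl K) (x ^ K) (dens C ^ K) ⟩
    cl K * (x ^ K * dens C ^ K)                 ≡⟨ cong (cl K *_) (sym (^-distrib-* x (dens C) K)) ⟩
    cl K * a ^ K                                ≡⟨ sym (ℚP.*-identityʳ _) ⟩
    Bound K 0                                   ∎
    where K = suc (suc k)

  -- Splitting the expansion of moment-suc: a shift y near g only shrinks the
  -- intersection, a shift far from g gives a separated (k+1)-tuple.
  split : ∀ {k} (g : Fin k → Fin P) m W → 0ℚ ≤ W → Separated g →
    (∀ (h : Fin (suc k) → Fin P) → Separated h → moment h m ≤ W) →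
    ∀ y → ind B y * moment (y ∷ g) m ≤ nearness g y * moment g m + ind B y * W
  split g m W 0≤W sep bound y with near? g y
  ... | yes near = begin
    ind B y * moment (y ∷ g) m     ≤⟨ mono-*ʳ (moment-nonNeg (y ∷ g) m) (indicator-≤1 B y) ⟩
    1ℚ * moment (y ∷ g) m          ≡⟨ ℚP.*-identityˡ _ ⟩
    moment (y ∷ g) m               ≤⟨ moment-cons≤ y g m ⟩
    moment g m                     ≡⟨ sym (ℚP.*-identityˡ _) ⟩
    1ℚ * moment g m                ≤⟨ mono-*ʳ (moment-nonNeg g m) (1≤nearness g y near) ⟩
    nearness g y * moment g m      ≤⟨ ≤+ʳ (0≤* (indicator-nonNeg B y) 0≤W) ⟩
    nearness g y * moment g m + ind B y * W  ∎
  ... | no far = begin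
    ind B y * moment (y ∷ g) m     ≤⟨ mono-*ˡ (indicator-nonNeg B y) (bound (y ∷ g) (separated-cons g y sep far)) ⟩
    ind B y * W                    ≤⟨ ≤+ˡ (0≤* (nearness-nonNeg g y) (moment-nonNeg g m)) ⟩
    nearness g y * moment g m + ind B y * W  ∎

  step : ∀ k m (g : Fin k → Fin P) → Separated g → moment g m ≤ Bound k m →
    (∀ (h : Fin (suc k) → Fin P) → Separated h → moment h m ≤ Bound (suc k) m) →
    moment g (suc m) ≤ Bound k (suc m)
  step k m g sep IHₖ IHₖ₊₁ = begin
    moment g (suc m)
      ≡⟨ moment-suc g m ⟩
    sumF (λ y → ind B y * moment (y ∷ g) m)
      ≤⟨ sumF-mono (split g m W (0≤Bound (suc k) m) sep IHₖ₊₁) ⟩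
    sumF (λ y → nearness g y * moment g m + ind B y * W)
      ≡⟨ trans (sumF-+ (λ y → nearness g y * moment g m) (λ y → ind B y * W))
               (cong₂ _+_ (sumF-*ʳ (moment g m) (nearness g)) (sumF-*ʳ W (ind B))) ⟩
    sumF (nearness g) * moment g m + sumF (ind B) * W
      ≡⟨ cong₂ (λ u v → u * moment g m + v * W) (sumF-nearness g) (sumF-indicator B) ⟩
    fromℕ k * ((fromℕ ∣ S' ∣) + (fromℕ ∣ S' ∣)) * moment g m + b * W
      ≤⟨ ℚP.+-monoˡ-≤ (b * W) (mono-* (moment-nonNeg g m) 0≤K (mono-*ˡ (0≤fromℕ k) |S'|-bound) IHₖ) ⟩
    K * Bound k m + b * W
      ≤⟨ ℚP.+-monoˡ-≤ (b * W) (mono-*ˡ 0≤K (mono-*ˡ (0≤* (0≤momentConst cl cl-pos t k m) (^-nonNeg k 0≤a))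
                                                    (^-≤-suc m 1≤e))) ⟩
    K * (V k m * a ^ k * e ^ suc m) + b * W
      ≡⟨ solve 8 (λ K v v' x d b aᵏ eᵐ →
                    K :* (v :* aᵏ :* ((x :* (d :* b)) :* eᵐ)) :+ b :* (v' :* ((x :* d) :* aᵏ) :* eᵐ)
                    := (K :* v :+ v') :* aᵏ :* ((x :* (d :* b)) :* eᵐ))
                 refl K (V k m) (V (suc k) m) x (dens C) b (a ^ k) (e ^ m) ⟩
    Bound k (suc m)  ∎
    where
    b = fromℕ ∣ B ∣
    W = Bound (suc k) m
    K = fromℕ k * (fromℕ t + fromℕ t)
    0≤K : 0ℚ ≤ K
    0≤K = 0≤* (0≤fromℕ k) (0≤+ (0≤fromℕ t) (0≤fromℕ t))
    |S'|-bound : (fromℕ ∣ S' ∣) + (fromℕ ∣ S' ∣) ≤ fromℕ t + fromℕ t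
    |S'|-bound = ℚP.+-mono-≤ (fromℕ-mono |S'|≤t) (fromℕ-mono |S'|≤t)

  -- The moment bound, by induction on m simultaneously for all tuple lengths k.
  moment-bound : ∀ m k (g : Fin k → Fin P) → Separated g → moment g m ≤ Bound k m
  moment-bound zero k g sep = base k g sep
  moment-bound (suc m) k g sep = step k m g sep (moment-bound m k g sep) (moment-bound m (suc k))

  normPow-bound : ∀ l → normPow l (conv (fSet C) (fSet B)) ≤ V 0 l * x ^ l
  normPow-bound l = begin
    normPow l (conv (fSet C) (fSet B))   ≡⟨ normPow-conv 0<dC 0<|B| l ⟩
    inv D ^ l * moment [] l              ≤⟨ mono-*ˡ (^-nonNeg l (ℚP.<⇒≤ (inv-pos D 0<D'))) (moment-bound l 0 [] (λ ())) ⟩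
    inv D ^ l * (V 0 l * 1ℚ * e ^ l)     ≡⟨ solve 3 (λ d v f → d :* (v :* con 1ℚ :* f) := v :* (d :* f)) refl (inv D ^ l) (V 0 l) (e ^ l) ⟩
    V 0 l * (inv D ^ l * e ^ l)          ≡⟨ cong (V 0 l *_) (sym (^-distrib-* (inv D) e l)) ⟩
    V 0 l * (inv D * e) ^ l              ≡⟨ cong (λ z → V 0 l * z ^ l) D⁻¹e≡x ⟩
    V 0 l * x ^ l                        ∎
    where
    0<D' = 0<D 0<dC 0<|B|
    D⁻¹e≡x : inv D * e ≡ x
    D⁻¹e≡x = trans (solve 3 (λ i x d → i :* (x :* d) := x :* (i :* d)) refl (inv D) x D)
                   (trans (cong (x *_) (inv-inverseˡ D 0<D')) (ℚP.*-identityʳ x))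

-- Theorem (Proposition 5): c = 1 + momentConst 0 l works, since momentConst 0 l ≤ c ≤ c^l.
proposition5 : (cl : ℕ → ℚ) → (∀ l → 2 ≤ℕ l → 0ℚ < cl l) →
  (t l : ℕ) → 2 ≤ℕ l →
  Σ ℚ λ c → 0ℚ < c ×
    ((P : ℕ) .{{_ : NonZero P}} → Prime P →
     (C : Subset P) → Nonempty C →
     (S' : Subset P) →
     (∀ x → x ∈ S' → ⊖ x ∈ S') → (∀ x → ⊖ x ∈ S' → x ∈ S') →
     zeroP ∈ S' → ∣ S' ∣ ≤ℕ t →
     (β : ℚ) → 0ℚ < β → β ≤ 1ℚ →
     (∀ k → 2 ≤ℕ k → (h : Fin k → Fin P) →
        (∀ i j → i ≢ j → (h i ⊝ h j) ∉ S') →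
        dens (interShifts C h) ≤ cl k * inv (β ^ k) * (dens C ^ k)) →
     (B : Subset P) → inv (dens C) ≤ (+ ∣ B ∣) / 1 →
     normPow l (conv (fSet C) (fSet B)) ≤ (c * inv β) ^ l)
proposition5 cl cl-pos t (suc l) (ℕ.s≤s _) = c , 0<c ,
  λ P _ C C≢∅ S' _ _ _ |S'|≤t β 0<β β≤1 intersection-bound B B-large → begin
    normPow (suc l) (conv (fSet C) (fSet B))
      ≤⟨ MomentBound.normPow-bound cl cl-pos t C C≢∅ S' |S'|≤t β 0<β β≤1 intersection-bound B B-large (suc l) ⟩
    V * inv β ^ suc l
      ≤⟨ mono-*ʳ (^-nonNeg (suc l) (ℚP.≤-trans 0≤1 (1≤inv 0<β β≤1))) (ℚP.≤-trans (≤+ˡ {1ℚ} {V} 0≤1) (≤^suc {c} l 1≤c)) ⟩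
    c ^ suc l * inv β ^ suc l
      ≡⟨ sym (^-distrib-* c (inv β) (suc l)) ⟩
    (c * inv β) ^ suc l  ∎
  where
  open ℚP.≤-Reasoning
  V c : ℚ
  V = momentConst cl t 0 (suc l)
  c = 1ℚ + V
  1≤c : 1ℚ ≤ c
  1≤c = ≤+ʳ (0≤momentConst cl cl-pos t 0 (suc l))
  0<c : 0ℚ < c
  0<c = ℚP.<-≤-trans (ℚP.positive⁻¹ 1ℚ) 1≤c
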